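{- Let $(a_n),(b_n),(a_n'),(b_n')$ be sequences of positive integers, and put $c_n=\frac{a_n}{b_n}$, $c_n'=\frac{a_n'}{b_n'}$. Assume that $b_n\mid b_{n+1}$ and $b_n'\mid b_{n+1}'$ for all $n\ge1$, that $\lim_{n\to\infty}a_n\frac{c_{n+1}}{c_n}=0$ and $\lim_{n\to\infty}a_n'\frac{c_{n+1}'}{c_n'}=0$ (so that $\alpha=\sum_{n=1}^\infty c_n$ and $\beta=\sum_{n=1}^\infty c_n'$ are convergent), and moreover that $$\lim_{n\to\infty}\frac{a_{n+1}b_n b_n'}{b_{n+1}}=0\quad\text{and}\quad \lim_{n\to\infty}\frac{a_{n+1}' b_n' b_n}{b_{n+1}'}=0 .$$ Then $\alpha+\beta$ is an irrational number. -}

module Defs where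

open import Data.Nat as ℕ using (ℕ; zero; suc; _∸_)
open import Data.Integer using (+_)
open import Data.Rational using (ℚ; 0ℚ; _/_; _+_; _-_; _*_; _÷_; ∣_∣; _<_; NonZero)
open import Data.Rational.Properties using (pos⇒nonZero; normalize-pos)
open import Data.Product using (Σ; ∃; _×_)

frac : (x y : ℕ) → 0 ℕ.< y → ℚ
frac x y p = (+ x / y) {{ℕ.>-nonZero p}}

frac-nonZero : ∀ x y (p : 0 ℕ.< y) → 0 ℕ.< x → NonZero (frac x y p)
frac-nonZero (suc x) y p _ =
  pos⇒nonZero (frac (suc x) y p) {{normalize-pos (suc x) y {{ℕ.>-nonZero p}}}}

ℕ→ℚ : ℕ → ℚ
ℕ→ℚ x = + x / 1

cseq : (a b : ℕ → ℕ) → (∀ n → 0 ℕ.< b n) → ℕ → ℚ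
cseq a b hb n = frac (a n) (b n) (hb n)

growth : (a b : ℕ → ℕ) → (∀ n → 0 ℕ.< a n) → (∀ n → 0 ℕ.< b n) → ℕ → ℚ
growth a b ha hb n =
  ((ℕ→ℚ (a n) * cseq a b hb (suc n)) ÷ cseq a b hb n)
    {{frac-nonZero (a n) (b n) (hb n) (ha n)}}

TendsTo : (ℕ → ℚ) → ℚ → Set
TendsTo f L = ∀ (ε : ℚ) → 0ℚ < ε →
  ∃ λ (N : ℕ) → ∀ n → N ℕ.≤ n → ∣ f n - L ∣ < ε

psum : (ℕ → ℚ) → ℕ → ℚ
psum f zero    = 0ℚ
psum f (suc N) = psum f N + f N

-- Let c n = a n / b n and c′ n = a′ n / b′ n, g n = c n + c′ n, d n = b n · b′ n.
-- Suppose ∑ g n converged to a rational r with denominator q.  The hypotheses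
-- a (n+1) b n b′ n / b (n+1) → 0 (and its primed twin) give an N with
--   a (n+1) · b n · b′ n · 4q < b (n+1)   for all n ≥ N   (and symmetrically),
-- which says two things at once:
--   (i)  from N on the terms of g at least halve, so the tail ∑_{m > N} g m is
--        at most 2 g (N+1);
--   (ii) q · d N · 2 g (N+1) < 1.
-- Since d n · g n is an integer and d n ∣ d (n+1), the partial sum
-- s = ∑_{m ≤ N} g m satisfies d N · s ∈ ℤ, hence q · d N · (r − s) is an
-- integer; by (i) and (ii) it lies strictly between 0 and 1, a contradiction.
module Submission where

open import Defs
open import Data.Nat as ℕ using (ℕ; zero; suc; z≤n; s≤s; _≤′_; ≤′-step; ≤′-refl)
import Data.Nat.Properties as ℕP
import Data.Nat.Solver
open import Data.Nat.Divisibility using (_∣_; *-pres-∣)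
open import Data.Integer as ℤ using (ℤ; +_; +≤+; +<+)
import Data.Integer.Properties as ℤP
import Data.Integer.Solver
open import Data.Rational
  using (ℚ; mkℚ; 0ℚ; 1ℚ; _+_; _*_; _-_; -_; _/_; _<_; _≤_; ∣_∣; toℚᵘ; ↧ₙ_; positive; nonNegative)
import Data.Rational.Properties as QP
open import Data.Rational.Solver using (module +-*-Solver)
open import Data.Rational.Unnormalised using (mkℚᵘ; *≡*; *<*; *≤*) renaming (_≃_ to _≃ᵘ_)
import Data.Rational.Unnormalised.Properties as UP
open import Data.Product using (Σ; ∃; _×_; _,_; proj₁; proj₂)
open import Data.Empty using (⊥; ⊥-elim)
open import Relation.Nullary using (¬_; yes; no)
open import Relation.Binary.PropositionalEquality

module ℕS = Data.Nat.Solver.+-*-Solver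
module ℤS = Data.Integer.Solver.+-*-Solver

-- The integer z as a rational; ℕ→ℚ m is definitionally ι (+ m).
ι : ℤ → ℚ
ι z = z / 1

toℚᵘ-/ : ∀ z k → toℚᵘ (z / suc k) ≃ᵘ mkℚᵘ z k
toℚᵘ-/ z k = QP.toℚᵘ-fromℚᵘ (mkℚᵘ z k)

ι-+ : ∀ z w → ι (z ℤ.+ w) ≡ ι z + ι w
ι-+ z w = QP.toℚᵘ-injective (UP.≃-trans (toℚᵘ-/ (z ℤ.+ w) 0)
  (UP.≃-sym (UP.≃-trans (QP.toℚᵘ-homo-+ (ι z) (ι w))
    (UP.≃-trans (UP.+-cong (toℚᵘ-/ z 0) (toℚᵘ-/ w 0)) (*≡* cross)))))
  where
  cross : (z ℤ.* + 1 ℤ.+ w ℤ.* + 1) ℤ.* + 1 ≡ (z ℤ.+ w) ℤ.* + 1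
  cross = cong (ℤ._* + 1) (cong₂ ℤ._+_ (ℤP.*-identityʳ z) (ℤP.*-identityʳ w))

ι-* : ∀ z w → ι (z ℤ.* w) ≡ ι z * ι w
ι-* z w = QP.toℚᵘ-injective (UP.≃-trans (toℚᵘ-/ (z ℤ.* w) 0)
  (UP.≃-sym (UP.≃-trans (QP.toℚᵘ-homo-* (ι z) (ι w)) (UP.*-cong (toℚᵘ-/ z 0) (toℚᵘ-/ w 0)))))

ι-neg : ∀ z → ι (ℤ.- z) ≡ - ι z
ι-neg z = QP.toℚᵘ-injective (UP.≃-trans (toℚᵘ-/ (ℤ.- z) 0)
  (UP.≃-sym (UP.≃-trans (QP.toℚᵘ-homo‿- (ι z)) (UP.-‿cong (toℚᵘ-/ z 0)))))

ι-cancel-< : ∀ z w → ι z < ι w → z ℤ.< w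
ι-cancel-< z w h
  with UP.<-resp-≃ .proj₂ (toℚᵘ-/ z 0) (UP.<-resp-≃ .proj₁ (toℚᵘ-/ w 0) (QP.toℚᵘ-mono-< h))
... | *<* h′ = subst₂ ℤ._<_ (ℤP.*-identityʳ z) (ℤP.*-identityʳ w) h′

ℕ→ℚ-* : ∀ m n → ℕ→ℚ (m ℕ.* n) ≡ ℕ→ℚ m * ℕ→ℚ n
ℕ→ℚ-* m n = trans (cong ι (ℤP.pos-* m n)) (ι-* (+ m) (+ n))

/-*-denominator : ∀ z k → (z / suc k) * ℕ→ℚ (suc k) ≡ ι z
/-*-denominator z k = QP.toℚᵘ-injective (UP.≃-trans (QP.toℚᵘ-homo-* (z / suc k) (ℕ→ℚ (suc k)))
  (UP.≃-trans (UP.*-cong (toℚᵘ-/ z k) (toℚᵘ-/ (+ suc k) 0))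
    (UP.≃-trans (*≡* cross) (UP.≃-sym (toℚᵘ-/ z 0)))))
  where
  cross : (z ℤ.* + suc k) ℤ.* + 1 ≡ z ℤ.* + (suc k ℕ.* 1)
  cross = trans (ℤP.*-identityʳ _) (cong (λ t → z ℤ.* + t) (sym (ℕP.*-identityʳ (suc k))))

frac-+ : ∀ x x′ y (p : 0 ℕ.< y) → frac x y p + frac x′ y p ≡ frac (x ℕ.+ x′) y p
frac-+ x x′ (suc k) p = QP.toℚᵘ-injective
  (UP.≃-trans (QP.toℚᵘ-homo-+ (frac x (suc k) p) (frac x′ (suc k) p))
    (UP.≃-trans (UP.+-cong (toℚᵘ-/ (+ x) k) (toℚᵘ-/ (+ x′) k))
      (UP.≃-trans (*≡* cross) (UP.≃-sym (toℚᵘ-/ (+ (x ℕ.+ x′)) k)))))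
  where
  cross : (+ x ℤ.* + suc k ℤ.+ + x′ ℤ.* + suc k) ℤ.* + suc k
        ≡ + (x ℕ.+ x′) ℤ.* + (suc k ℕ.* suc k)
  cross = trans (ℤS.solve 3 (λ X X′ K → (X ℤS.:* K ℤS.:+ X′ ℤS.:* K) ℤS.:* K
                                      ℤS.:= (X ℤS.:+ X′) ℤS.:* (K ℤS.:* K))
                   refl (+ x) (+ x′) (+ suc k))
                (cong (+ (x ℕ.+ x′) ℤ.*_) (ℤP.pos-* (suc k) (suc k)))

frac-scale : ∀ m x y (p : 0 ℕ.< y) → ℕ→ℚ m * frac x y p ≡ frac (m ℕ.* x) y p
frac-scale m x (suc k) p = QP.toℚᵘ-injective
  (UP.≃-trans (QP.toℚᵘ-homo-* (ℕ→ℚ m) (frac x (suc k) p))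
    (UP.≃-trans (UP.*-cong (toℚᵘ-/ (+ m) 0) (toℚᵘ-/ (+ x) k))
      (UP.≃-trans (*≡* cross) (UP.≃-sym (toℚᵘ-/ (+ (m ℕ.* x)) k)))))
  where
  cross : (+ m ℤ.* + x) ℤ.* + suc k ≡ + (m ℕ.* x) ℤ.* + (1 ℕ.* suc k)
  cross = cong₂ ℤ._*_ (sym (ℤP.pos-* m x)) (cong +_ (sym (ℕP.*-identityˡ (suc k))))

frac-≤ : ∀ x y x′ y′ (p : 0 ℕ.< y) (p′ : 0 ℕ.< y′)
  → x ℕ.* y′ ℕ.≤ x′ ℕ.* y → frac x y p ≤ frac x′ y′ p′
frac-≤ x (suc k) x′ (suc k′) p p′ h =
  QP.toℚᵘ-cancel-≤ (UP.≤-resp₂-≃ .proj₂ (UP.≃-sym (toℚᵘ-/ (+ x) k))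
    (UP.≤-resp₂-≃ .proj₁ (UP.≃-sym (toℚᵘ-/ (+ x′) k′)) (*≤* cross)))
  where
  cross : + x ℤ.* + suc k′ ℤ.≤ + x′ ℤ.* + suc k
  cross = subst₂ ℤ._≤_ (ℤP.pos-* x (suc k′)) (ℤP.pos-* x′ (suc k)) (+≤+ h)

frac-< : ∀ x y x′ y′ (p : 0 ℕ.< y) (p′ : 0 ℕ.< y′)
  → x ℕ.* y′ ℕ.< x′ ℕ.* y → frac x y p < frac x′ y′ p′
frac-< x (suc k) x′ (suc k′) p p′ h =
  QP.toℚᵘ-cancel-< (UP.<-resp-≃ .proj₂ (UP.≃-sym (toℚᵘ-/ (+ x) k))
    (UP.<-resp-≃ .proj₁ (UP.≃-sym (toℚᵘ-/ (+ x′) k′)) (*<* cross)))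
  where
  cross : + x ℤ.* + suc k′ ℤ.< + x′ ℤ.* + suc k
  cross = subst₂ ℤ._<_ (ℤP.pos-* x (suc k′)) (ℤP.pos-* x′ (suc k)) (+<+ h)

frac-cancel-< : ∀ x y x′ y′ (p : 0 ℕ.< y) (p′ : 0 ℕ.< y′)
  → frac x y p < frac x′ y′ p′ → x ℕ.* y′ ℕ.< x′ ℕ.* y
frac-cancel-< x (suc k) x′ (suc k′) p p′ h
  with UP.<-resp-≃ .proj₂ (toℚᵘ-/ (+ x) k)
         (UP.<-resp-≃ .proj₁ (toℚᵘ-/ (+ x′) k′) (QP.toℚᵘ-mono-< h))
... | *<* cross with subst₂ ℤ._<_ (sym (ℤP.pos-* x (suc k′))) (sym (ℤP.pos-* x′ (suc k))) cross
...   | +<+ h′ = h′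

frac-pos : ∀ x y (p : 0 ℕ.< y) → 0 ℕ.< x → 0ℚ < frac x y p
frac-pos x y p x>0 = frac-< 0 1 x y (s≤s z≤n) p (subst (0 ℕ.<_) (sym (ℕP.*-identityʳ x)) x>0)

↧ₙ-pos : ∀ r → 0 ℕ.< ↧ₙ r
↧ₙ-pos (mkℚ _ _ _) = s≤s z≤n

m*n>0 : ∀ {m n} → 0 ℕ.< m → 0 ℕ.< n → 0 ℕ.< m ℕ.* n
m*n>0 {suc m} {suc n} _ _ = s≤s z≤n

-- Integral rationals

Integral : ℚ → Set
Integral p = Σ ℤ λ z → p ≡ ι z

integral-ℕ : ∀ m → Integral (ℕ→ℚ m)
integral-ℕ m = + m , refl

integral-+ : ∀ {p p′} → Integral p → Integral p′ → Integral (p + p′)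
integral-+ (z , refl) (w , refl) = z ℤ.+ w , sym (ι-+ z w)

integral-* : ∀ {p p′} → Integral p → Integral p′ → Integral (p * p′)
integral-* (z , refl) (w , refl) = z ℤ.* w , sym (ι-* z w)

integral-neg : ∀ {p} → Integral p → Integral (- p)
integral-neg (z , refl) = ℤ.- z , sym (ι-neg z)

integral-×-denominator : ∀ r → Integral (r * ℕ→ℚ (↧ₙ r))
integral-×-denominator r@(mkℚ n d _) =
  n , trans (cong (_* ℕ→ℚ (suc d)) (sym (QP.↥p/↧p≡p r))) (/-*-denominator n d)

integral-frac : ∀ x y (p : 0 ℕ.< y) → Integral (ℕ→ℚ y * frac x y p)
integral-frac x (suc k) p =
  + x , trans (QP.*-comm (ℕ→ℚ (suc k)) (frac x (suc k) p)) (/-*-denominator (+ x) k)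

integral-not-in-unit-interval : ∀ {p} → Integral p → 0ℚ < p → p < 1ℚ → ⊥
integral-not-in-unit-interval (z , refl) p>0 p<1 =
  no-integer-between (ι-cancel-< (+ 0) z p>0) (ι-cancel-< z (+ 1) p<1)
  where
  no-integer-between : ∀ {z} → + 0 ℤ.< z → z ℤ.< + 1 → ⊥
  no-integer-between {+ zero} (+<+ ()) _
  no-integer-between {+ suc n} _ (+<+ (s≤s ()))

p≤p+q : ∀ p {q} → 0ℚ ≤ q → p ≤ p + q
p≤p+q p {q} q≥0 = subst (_≤ p + q) (QP.+-identityʳ p) (QP.+-monoʳ-≤ p q≥0)

psum-mono : ∀ f → (∀ n → 0ℚ ≤ f n) → ∀ {m n} → m ≤′ n → psum f m ≤ psum f n
psum-mono f f≥0 ≤′-refl = QP.≤-refl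
psum-mono f f≥0 (≤′-step {n} h) =
  QP.≤-trans (psum-mono f f≥0 h) (p≤p+q (psum f n) (f≥0 n))

-- If the terms halve from N on, then psum f m + 2 f m is nonincreasing from N on;
-- in particular the tail after M ≥ N is bounded by 2 f M.
halving-majorant : ∀ f N → (∀ n → N ℕ.≤ n → f (suc n) + f (suc n) ≤ f n)
  → ∀ {M m} → N ℕ.≤ M → M ≤′ m → psum f m + (f m + f m) ≤ psum f M + (f M + f M)
halving-majorant f N halving N≤M ≤′-refl = QP.≤-refl
halving-majorant f N halving N≤M (≤′-step {m} h) = QP.≤-trans step (halving-majorant f N halving N≤M h)
  where
  step : psum f (suc m) + (f (suc m) + f (suc m)) ≤ psum f m + (f m + f m)
  step = subst (psum f (suc m) + (f (suc m) + f (suc m)) ≤_) (QP.+-assoc (psum f m) (f m) (f m))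
    (QP.+-monoʳ-≤ (psum f m + f m) (halving m (ℕP.≤-trans N≤M (ℕP.≤′⇒≤ h))))

p≤∣p∣ : ∀ p → p ≤ ∣ p ∣
p≤∣p∣ (mkℚ (+ n) d c) = QP.≤-refl
p≤∣p∣ p@(mkℚ ℤ.-[1+ n ] d c) =
  QP.≤-trans (QP.nonPositive⁻¹ p) (QP.nonNegative⁻¹ ∣ p ∣ {{QP.∣-∣-nonNeg p}})

∣p-q∣≡∣q-p∣ : ∀ p q → ∣ p - q ∣ ≡ ∣ q - p ∣
∣p-q∣≡∣q-p∣ p q = trans (sym (QP.∣-p∣≡∣p∣ (p - q))) (cong ∣_∣ (neg-diff p q))
  where
  open +-*-Solver
  neg-diff : ∀ p q → - (p - q) ≡ q - p
  neg-diff = solve 2 (λ p q → :- (p :- q) := q :- p) refl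

0<q-p : ∀ {p q} → p < q → 0ℚ < q - p
0<q-p {p} {q} p<q = subst (_< q - p) (QP.+-inverseʳ p) (QP.+-monoˡ-< (- p) p<q)

limit-≤ : ∀ S r U K → TendsTo S r → (∀ m → K ℕ.≤ m → S m ≤ U) → r ≤ U
limit-≤ S r U K S→r bound with r QP.≤? U
... | yes r≤U = r≤U
... | no r≰U = ⊥-elim (QP.<-irrefl refl (QP.<-≤-trans close far))
  where
  ε = r - U
  ε>0 = 0<q-p (QP.≰⇒> r≰U)
  m = proj₁ (S→r ε ε>0) ℕ.⊔ K
  close : ∣ S m - r ∣ < ε
  close = proj₂ (S→r ε ε>0) m (ℕP.m≤m⊔n _ K)
  far : ε ≤ ∣ S m - r ∣
  far = QP.≤-trans (QP.+-monoʳ-≤ r (QP.neg-antimono-≤ (bound m (ℕP.m≤n⊔m _ K))))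
          (QP.≤-trans (p≤∣p∣ (r - S m)) (QP.≤-reflexive (∣p-q∣≡∣q-p∣ r (S m))))

limit-≥ : ∀ S r L K → TendsTo S r → (∀ m → K ℕ.≤ m → L ≤ S m) → L ≤ r
limit-≥ S r L K S→r bound with L QP.≤? r
... | yes L≤r = L≤r
... | no L≰r = ⊥-elim (QP.<-irrefl refl (QP.<-≤-trans close far))
  where
  ε = L - r
  ε>0 = 0<q-p (QP.≰⇒> L≰r)
  m = proj₁ (S→r ε ε>0) ℕ.⊔ K
  close : ∣ S m - r ∣ < ε
  close = proj₂ (S→r ε ε>0) m (ℕP.m≤m⊔n _ K)
  far : ε ≤ ∣ S m - r ∣
  far = QP.≤-trans (QP.+-monoˡ-≤ (- r) (bound m (ℕP.m≤n⊔m _ K))) (p≤∣p∣ (S m - r))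

-- The irrationality criterion

-- If D·s is an integer and q is the denominator of r, then r cannot lie in
-- (s, s + B] when q·D·B < 1: otherwise q·D·(r − s) is an integer in (0, 1).
denominator-gap : ∀ r s B D → 0 ℕ.< D → Integral (ℕ→ℚ D * s)
  → s < r → r ≤ s + B → ℕ→ℚ (↧ₙ r ℕ.* D) * B < 1ℚ → ⊥
denominator-gap r s B D D>0 Ds-integral s<r r≤s+B qDB<1 = integral-not-in-unit-interval W-integral W>0 W<1
  where
  q = ↧ₙ r
  Q = ℕ→ℚ (q ℕ.* D)
  W = Q * (r - s)

  -- q·D·(r − s) = D · (q·r) − q · (D·s), a difference of integers.
  expand : ℕ→ℚ q * ℕ→ℚ D * (r - s) ≡ ℕ→ℚ D * (r * ℕ→ℚ q) + - (ℕ→ℚ q * (ℕ→ℚ D * s))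
  expand = solve 4 (λ Q D r s → Q :* D :* (r :- s) := D :* (r :* Q) :+ :- (Q :* (D :* s)))
                   refl (ℕ→ℚ q) (ℕ→ℚ D) r s
    where open +-*-Solver

  W-integral : Integral W
  W-integral = subst Integral (sym (trans (cong (_* (r - s)) (ℕ→ℚ-* q D)) expand))
    (integral-+ (integral-* (integral-ℕ D) (integral-×-denominator r))
                (integral-neg (integral-* (integral-ℕ q) Ds-integral)))

  Q>0 : 0ℚ < Q
  Q>0 = frac-pos (q ℕ.* D) 1 (s≤s z≤n) (m*n>0 (↧ₙ-pos r) D>0)

  W>0 : 0ℚ < W
  W>0 = subst (_< W) (QP.*-zeroʳ Q) (QP.*-monoʳ-<-pos Q {{positive Q>0}} (0<q-p s<r))

  W<1 : W < 1ℚ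
  W<1 = QP.≤-<-trans (QP.*-monoˡ-≤-nonNeg Q {{nonNegative (QP.<⇒≤ Q>0)}} r-s≤B) qDB<1
    where
    r-s≤B : r - s ≤ B
    r-s≤B = subst (r - s ≤_) (solve 2 (λ s B → s :+ B :- s := B) refl s B) (QP.+-monoˡ-≤ (- s) r≤s+B)
      where open +-*-Solver

psum-integral : (f : ℕ → ℚ) (d : ℕ → ℕ)
  → (∀ n → Integral (ℕ→ℚ (d n) * f n)) → (∀ n → d n ∣ d (suc n))
  → ∀ n → Integral (ℕ→ℚ (d n) * psum f (suc n))
psum-integral f d term-integral chain zero =
  subst Integral (cong (ℕ→ℚ (d 0) *_) (sym (QP.+-identityˡ (f 0)))) (term-integral 0)
psum-integral f d term-integral chain (suc n) =
  subst Integral (sym split)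
    (integral-+ (integral-* (integral-ℕ k) (psum-integral f d term-integral chain n)) (term-integral (suc n)))
  where
  open ≡-Reasoning
  k = _∣_.quotient (chain n)
  D D′ K P F : ℚ
  D = ℕ→ℚ (d n)
  D′ = ℕ→ℚ (d (suc n))
  K = ℕ→ℚ k
  P = psum f (suc n)
  F = f (suc n)
  D′≡K*D : D′ ≡ K * D
  D′≡K*D = trans (cong ℕ→ℚ (_∣_.equality (chain n))) (ℕ→ℚ-* k (d n))
  split : D′ * (P + F) ≡ K * (D * P) + D′ * F
  split = begin
    D′ * (P + F)     ≡⟨ QP.*-distribˡ-+ D′ P F ⟩
    D′ * P + D′ * F  ≡⟨ cong (λ t → t * P + D′ * F) D′≡K*D ⟩
    K * D * P + D′ * F ≡⟨ cong (_+ D′ * F) (QP.*-assoc K D P) ⟩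
    K * (D * P) + D′ * F ∎

irrationality-criterion : (f : ℕ → ℚ) (d : ℕ → ℕ)
  → (∀ n → 0ℚ < f n) → (∀ n → 0 ℕ.< d n)
  → (∀ n → Integral (ℕ→ℚ (d n) * f n)) → (∀ n → d n ∣ d (suc n))
  → (∀ q → 0 ℕ.< q → ∃ λ N → (∀ n → N ℕ.≤ n → f (suc n) + f (suc n) ≤ f n)
                              × ℕ→ℚ (q ℕ.* d N) * (f (suc N) + f (suc N)) < 1ℚ)
  → ¬ Σ ℚ λ r → TendsTo (psum f) r
irrationality-criterion f d f>0 d>0 term-integral chain small (r , S→r)
  with small (↧ₙ r) (↧ₙ-pos r)
... | N , halving , tiny =
  denominator-gap r (psum f M) (f M + f M) (d N) (d>0 N) (psum-integral f d term-integral chain N) below above tiny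
  where
  M = suc N
  f≥0 : ∀ n → 0ℚ ≤ f n
  f≥0 n = QP.<⇒≤ (f>0 n)

  above : r ≤ psum f M + (f M + f M)
  above = limit-≤ (psum f) r (psum f M + (f M + f M)) M S→r λ m M≤m →
    QP.≤-trans (p≤p+q (psum f m) (QP.+-mono-≤ (f≥0 m) (f≥0 m)))
               (halving-majorant f N halving (ℕP.n≤1+n N) (ℕP.≤⇒≤′ M≤m))

  below : psum f M < r
  below = QP.<-≤-trans M-th-step
    (limit-≥ (psum f) r (psum f (suc M)) (suc M) S→r λ m h → psum-mono f f≥0 (ℕP.≤⇒≤′ h))
    where
    M-th-step : psum f M < psum f (suc M)
    M-th-step = subst (_< psum f M + f M) (QP.+-identityʳ (psum f M)) (QP.+-monoʳ-< (psum f M) (f>0 M))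

eventually-small : (x y : ℕ → ℕ) (hy : ∀ n → 0 ℕ.< y n)
  → TendsTo (λ n → frac (x n) (y n) (hy n)) 0ℚ
  → ∀ K → 0 ℕ.< K → ∃ λ N → ∀ n → N ℕ.≤ n → x n ℕ.* K ℕ.< y n
eventually-small x y hy x/y→0 K K>0 = N , small
  where
  ε = frac 1 K K>0
  ε>0 = frac-pos 1 K K>0 (s≤s z≤n)
  N = proj₁ (x/y→0 ε ε>0)
  small : ∀ n → N ℕ.≤ n → x n ℕ.* K ℕ.< y n
  small n N≤n =
    subst (x n ℕ.* K ℕ.<_) (ℕP.*-identityˡ (y n)) (frac-cancel-< (x n) (y n) 1 K (hy n) K>0 x/y<ε)
    where
    x/y≥0 : 0ℚ ≤ frac (x n) (y n) (hy n)
    x/y≥0 = frac-≤ 0 1 (x n) (y n) (s≤s z≤n) (hy n) z≤n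
    x/y<ε : frac (x n) (y n) (hy n) < ε
    x/y<ε = subst (_< ε) (trans (cong ∣_∣ (QP.+-identityʳ _)) (QP.0≤p⇒∣p∣≡p x/y≥0))
                  (proj₂ (x/y→0 ε ε>0) n N≤n)

module SmallStep (a b e : ℕ → ℕ) (hb : ∀ n → 0 ℕ.< b n) (q n : ℕ) (q>0 : 0 ℕ.< q)
    (an>0 : 0 ℕ.< a n) (en>0 : 0 ℕ.< e n)
    (small : a (suc n) ℕ.* b n ℕ.* e n ℕ.* (4 ℕ.* q) ℕ.< b (suc n)) where

  c : ℕ → ℚ
  c = cseq a b hb

  twice-next : c (suc n) + c (suc n) ≡ frac (a (suc n) ℕ.+ a (suc n)) (b (suc n)) (hb (suc n))
  twice-next = frac-+ (a (suc n)) (a (suc n)) (b (suc n)) (hb (suc n))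

  halving : c (suc n) + c (suc n) ≤ c n
  halving = subst (_≤ c n) (sym twice-next)
    (frac-≤ (a (suc n) ℕ.+ a (suc n)) (b (suc n)) (a n) (b n) (hb (suc n)) (hb n) cross)
    where
    open ℕP.≤-Reasoning
    x = a (suc n) ℕ.* b n
    2≤4q : 2 ℕ.≤ 4 ℕ.* q
    2≤4q = ℕP.≤-trans (ℕP.m≤m+n 2 2) (ℕP.m≤m*n 4 q {{ℕ.>-nonZero q>0}})
    2≤e·4q : 2 ℕ.≤ e n ℕ.* (4 ℕ.* q)
    2≤e·4q = ℕP.≤-trans 2≤4q (ℕP.m≤n*m (4 ℕ.* q) (e n) {{ℕ.>-nonZero en>0}})
    double : (a (suc n) ℕ.+ a (suc n)) ℕ.* b n ≡ x ℕ.* 2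
    double = ℕS.solve 2 (λ a b → (a ℕS.:+ a) ℕS.:* b ℕS.:= a ℕS.:* b ℕS.:* ℕS.con 2) refl (a (suc n)) (b n)
    cross : (a (suc n) ℕ.+ a (suc n)) ℕ.* b n ℕ.≤ a n ℕ.* b (suc n)
    cross = begin
      (a (suc n) ℕ.+ a (suc n)) ℕ.* b n ≡⟨ double ⟩
      x ℕ.* 2                           ≤⟨ ℕP.*-monoʳ-≤ x 2≤e·4q ⟩
      x ℕ.* (e n ℕ.* (4 ℕ.* q))         ≡⟨ ℕP.*-assoc x (e n) (4 ℕ.* q) ⟨
      x ℕ.* e n ℕ.* (4 ℕ.* q)           ≤⟨ ℕP.<⇒≤ small ⟩
      b (suc n)                         ≤⟨ ℕP.m≤n*m (b (suc n)) (a n) {{ℕ.>-nonZero an>0}} ⟩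
      a n ℕ.* b (suc n)                 ∎

  below-half : ℕ→ℚ (q ℕ.* (b n ℕ.* e n)) * (c (suc n) + c (suc n)) < frac 1 2 (s≤s z≤n)
  below-half = subst (_< frac 1 2 (s≤s z≤n)) (sym scaled)
    (frac-< X (b (suc n)) 1 2 (hb (suc n)) (s≤s z≤n)
      (subst₂ ℕ._<_ (sym regroup) (sym (ℕP.*-identityˡ _)) small))
    where
    Q = q ℕ.* (b n ℕ.* e n)
    X = Q ℕ.* (a (suc n) ℕ.+ a (suc n))
    scaled : ℕ→ℚ Q * (c (suc n) + c (suc n)) ≡ frac X (b (suc n)) (hb (suc n))
    scaled = trans (cong (ℕ→ℚ Q *_) twice-next)
                   (frac-scale Q (a (suc n) ℕ.+ a (suc n)) (b (suc n)) (hb (suc n)))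
    regroup : X ℕ.* 2 ≡ a (suc n) ℕ.* b n ℕ.* e n ℕ.* (4 ℕ.* q)
    regroup = ℕS.solve 4 (λ q b e a → q ℕS.:* (b ℕS.:* e) ℕS.:* (a ℕS.:+ a) ℕS.:* ℕS.con 2
                                    ℕS.:= a ℕS.:* b ℕS.:* e ℕS.:* (ℕS.con 4 ℕS.:* q))
                         refl q (b n) (e n) (a (suc n))

integral-frac-+ : ∀ x y x′ y′ (p : 0 ℕ.< y) (p′ : 0 ℕ.< y′)
  → Integral (ℕ→ℚ (y ℕ.* y′) * (frac x y p + frac x′ y′ p′))
integral-frac-+ x y x′ y′ p p′ = subst Integral (sym regroup)
  (integral-+ (integral-* (integral-ℕ y′) (integral-frac x y p))
              (integral-* (integral-ℕ y) (integral-frac x′ y′ p′)))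
  where
  open +-*-Solver
  F = frac x y p
  F′ = frac x′ y′ p′
  regroup : ℕ→ℚ (y ℕ.* y′) * (F + F′) ≡ ℕ→ℚ y′ * (ℕ→ℚ y * F) + ℕ→ℚ y * (ℕ→ℚ y′ * F′)
  regroup = trans (cong (_* (F + F′)) (ℕ→ℚ-* y y′))
    (solve 4 (λ Y Y′ F F′ → Y :* Y′ :* (F :+ F′) := Y′ :* (Y :* F) :+ Y :* (Y′ :* F′))
             refl (ℕ→ℚ y) (ℕ→ℚ y′) F F′)

module TwoSmallSteps (a b a′ b′ : ℕ → ℕ) (hb : ∀ n → 0 ℕ.< b n) (hb′ : ∀ n → 0 ℕ.< b′ n)
    (q n : ℕ) (q>0 : 0 ℕ.< q) (an>0 : 0 ℕ.< a n) (a′n>0 : 0 ℕ.< a′ n)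
    (small : a (suc n) ℕ.* b n ℕ.* b′ n ℕ.* (4 ℕ.* q) ℕ.< b (suc n))
    (small′ : a′ (suc n) ℕ.* b′ n ℕ.* b n ℕ.* (4 ℕ.* q) ℕ.< b′ (suc n)) where

  module First = SmallStep a b b′ hb q n q>0 an>0 (hb′ n) small
  module Second = SmallStep a′ b′ b hb′ q n q>0 a′n>0 (hb n) small′
  open First using (c)
  open Second using () renaming (c to c′)

  g : ℕ → ℚ
  g m = c m + c′ m

  interchange : ∀ x x′ → (x + x′) + (x + x′) ≡ (x + x) + (x′ + x′)
  interchange = solve 2 (λ x x′ → (x :+ x′) :+ (x :+ x′) := (x :+ x) :+ (x′ :+ x′)) refl
    where open +-*-Solver

  halving : g (suc n) + g (suc n) ≤ g n
  halving = subst (_≤ g n) (sym (interchange (c (suc n)) (c′ (suc n))))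
    (QP.+-mono-≤ First.halving Second.halving)

  below-one : ℕ→ℚ (q ℕ.* (b n ℕ.* b′ n)) * (g (suc n) + g (suc n)) < 1ℚ
  below-one = subst (_< 1ℚ) (sym split) (QP.+-mono-< First.below-half second-below-half)
    where
    Q = ℕ→ℚ (q ℕ.* (b n ℕ.* b′ n))
    split : Q * (g (suc n) + g (suc n)) ≡ Q * (c (suc n) + c (suc n)) + Q * (c′ (suc n) + c′ (suc n))
    split = trans (cong (Q *_) (interchange (c (suc n)) (c′ (suc n)))) (QP.*-distribˡ-+ Q _ _)
    second-below-half : Q * (c′ (suc n) + c′ (suc n)) < frac 1 2 (s≤s z≤n)
    second-below-half = subst (λ m → ℕ→ℚ (q ℕ.* m) * (c′ (suc n) + c′ (suc n)) < frac 1 2 (s≤s z≤n))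
                              (ℕP.*-comm (b′ n) (b n)) Second.below-half

theorem3 : (a b a′ b′ : ℕ → ℕ)
    → (ha : ∀ n → 0 ℕ.< a n) (hb : ∀ n → 0 ℕ.< b n)
    → (ha′ : ∀ n → 0 ℕ.< a′ n) (hb′ : ∀ n → 0 ℕ.< b′ n)
    → (∀ n → b n ∣ b (suc n))
    → (∀ n → b′ n ∣ b′ (suc n))
    → TendsTo (growth a b ha hb) 0ℚ
    → TendsTo (growth a′ b′ ha′ hb′) 0ℚ
    → TendsTo (λ n → frac (a (suc n) ℕ.* b n ℕ.* b′ n) (b (suc n)) (hb (suc n))) 0ℚ
    → TendsTo (λ n → frac (a′ (suc n) ℕ.* b′ n ℕ.* b n) (b′ (suc n)) (hb′ (suc n))) 0ℚ
    → ¬ (Σ ℚ λ r → TendsTo (psum (λ n → cseq a b hb n + cseq a′ b′ hb′ n)) r)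
theorem3 a b a′ b′ ha hb ha′ hb′ b-chain b′-chain _ _ small-b small-b′ =
  irrationality-criterion g d g>0 d>0 (λ n → integral-frac-+ (a n) (b n) (a′ n) (b′ n) (hb n) (hb′ n))
    (λ n → *-pres-∣ (b-chain n) (b′-chain n)) smallness
  where
  g : ℕ → ℚ
  g n = cseq a b hb n + cseq a′ b′ hb′ n
  d : ℕ → ℕ
  d n = b n ℕ.* b′ n
  g>0 : ∀ n → 0ℚ < g n
  g>0 n = QP.+-mono-< (frac-pos (a n) (b n) (hb n) (ha n)) (frac-pos (a′ n) (b′ n) (hb′ n) (ha′ n))
  d>0 : ∀ n → 0 ℕ.< d n
  d>0 n = m*n>0 (hb n) (hb′ n)

  -- The last two hypotheses, made quantitative with K = 4q, give the criterion's N.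
  smallness : ∀ q → 0 ℕ.< q → ∃ λ N → (∀ n → N ℕ.≤ n → g (suc n) + g (suc n) ≤ g n)
                                      × ℕ→ℚ (q ℕ.* d N) * (g (suc N) + g (suc N)) < 1ℚ
  smallness q q>0
    with eventually-small (λ n → a (suc n) ℕ.* b n ℕ.* b′ n) (λ n → b (suc n)) (λ n → hb (suc n))
                          small-b (4 ℕ.* q) (m*n>0 {4} (s≤s z≤n) q>0)
       | eventually-small (λ n → a′ (suc n) ℕ.* b′ n ℕ.* b n) (λ n → b′ (suc n)) (λ n → hb′ (suc n))
                          small-b′ (4 ℕ.* q) (m*n>0 {4} (s≤s z≤n) q>0)
  ... | N₁ , small₁ | N₂ , small₂ = N , Step.halving , Step.below-one N ℕP.≤-refl
    where
    N = N₁ ℕ.⊔ N₂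
    module Step (n : ℕ) (N≤n : N ℕ.≤ n) = TwoSmallSteps a b a′ b′ hb hb′ q n q>0 (ha n) (ha′ n)
      (small₁ n (ℕP.≤-trans (ℕP.m≤m⊔n N₁ N₂) N≤n))
      (small₂ n (ℕP.≤-trans (ℕP.m≤n⊔m N₁ N₂) N≤n))
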